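{- Let $n\ge 1$ be an integer such that $p=4n+3$ is a prime, let $D$ be the set of non-zero squares of $\mathbb{Z}_p$ (the Paley $(4n+3,2n+1,n)$ difference set), and let $\Gamma=C(\mathbb{Z}_{2n+1};S)$ be a circulant graph of order $2n+1$, where $S\subseteq\{1,\dots,n\}$. Then $\Gamma$ is $D$-graceful: there is an injective map $f:\mathbb{Z}_{2n+1}\to D$ such that, for every non-zero $x\in\mathbb{Z}_p$, the number of ordered pairs $(a,b)$ of adjacent vertices of $\Gamma$ with $f(a)-f(b)=x$ equals $\lambda$, where $\lambda=\frac{2|E(\Gamma)|}{p-1}$.
   Context: For $S\subseteq\{1,\dots,\lfloor m/2\rfloor\}$, the circulant graph $C(\mathbb{Z}_m;S)$ has vertex set $\mathbb{Z}_m$ and edges all pairs $\{x,x+s\}$ with $x\in\mathbb{Z}_m$, $s\in S$. -}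

module Defs where

open import Data.Nat using (ℕ; zero; suc; _+_; _*_; _∸_; _<_; NonZero)
open import Data.Nat.DivMod using (_%_)
open import Data.Nat.Properties using (_≟_; _<?_)
open import Data.Fin using (Fin; toℕ)
open import Data.Fin.Subset using (Subset; _∈_)
open import Data.Fin.Subset.Properties using (_∈?_)
open import Data.Fin.Properties using (any?)
open import Data.Product using (_×_; _,_; ∃-syntax; Σ-syntax)
open import Data.Sum using (_⊎_)
open import Data.List using (List; length; filter; allFin; cartesianProduct)
open import Relation.Nullary using (Dec; ¬_)
open import Relation.Nullary.Decidable using (_×-dec_; _⊎-dec_)
open import Relation.Binary.PropositionalEquality using (_≡_)

diffMod : (p : ℕ) .{{_ : NonZero p}} → Fin p → Fin p → ℕ
diffMod p x y = (toℕ x + (p ∸ toℕ y)) % p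

IsNonzeroSquare : (p : ℕ) .{{_ : NonZero p}} → Fin p → Set
IsNonzeroSquare p x = ¬ (toℕ x ≡ 0) × Σ[ y ∈ Fin p ] ((toℕ y * toℕ y) % p ≡ toℕ x)

-- Circulant graph C(ℤ_m ; S) with S ⊆ {1,…,n}.  A subset S : Subset n
-- encodes the connection set { i+1 | i ∈ S }.
-- a ~ b iff {a,b} = {x, x+s} for some s ∈ S, i.e. b = a+s or a = b+s.
CircAdj : (m n : ℕ) .{{_ : NonZero m}} → Subset n → Fin m → Fin m → Set
CircAdj m n S a b =
  ∃[ i ] (i ∈ S × ((toℕ a + suc (toℕ i)) % m ≡ toℕ b
                   ⊎ (toℕ b + suc (toℕ i)) % m ≡ toℕ a))

circAdj? : (m n : ℕ) .{{_ : NonZero m}} → (S : Subset n) → (a b : Fin m) →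
           Dec (CircAdj m n S a b)
circAdj? m n S a b = any? λ i → (i ∈? S) ×-dec
  (((toℕ a + suc (toℕ i)) % m ≟ toℕ b) ⊎-dec ((toℕ b + suc (toℕ i)) % m ≟ toℕ a))

allPairs : (m : ℕ) → List (Fin m × Fin m)
allPairs m = cartesianProduct (allFin m) (allFin m)

numEdges : (m n : ℕ) .{{_ : NonZero m}} → Subset n → ℕ
numEdges m n S = length (filter
  (λ { (a , b) → (toℕ a <? toℕ b) ×-dec circAdj? m n S a b }) (allPairs m))

numDiffPairs : (m n p : ℕ) .{{_ : NonZero m}} .{{_ : NonZero p}} →
               Subset n → (Fin m → Fin p) → Fin p → ℕ
numDiffPairs m n p S f x = length (filter
  (λ { (a , b) → circAdj? m n S a b ×-dec (diffMod p (f a) (f b) ≟ toℕ x) })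
  (allPairs m))

module Submission where

-- The non-zero squares mod p = 4n + 3 form the cyclic subgroup of order m = 2n + 1 of the units,
-- so with h a generator the labelling a ↦ h^a is injective into D.  Rotating the circulant graph by
-- j multiplies every label difference by h^j, and reversing an edge negates it; since m is odd,
-- −1 is not a power of h, so ±h^j (j < m) are all p − 1 units and the number of ordered adjacent
-- pairs with difference x is the same for every x ≠ 0.  Difference 0 never occurs, so summing
-- over x, (p − 1) times this number is the number 2|E| of ordered adjacent pairs.

open import Level using (0ℓ)
open import Algebra.Bundles using (CommutativeMonoid)
import Algebra.Properties.CommutativeMonoid.Sum as MonoidSum
import Algebra.Properties.CommutativeSemigroup as CommutativeSemigroupProperties
open import Data.Bool using (true; false; if_then_else_)
open import Data.Fin as Fin using (Fin; toℕ; fromℕ<; punchOut; splitAt; join)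
open import Data.Fin.Permutation using (Permutation′; permutation)
open import Data.Fin.Properties
  using (toℕ-fromℕ<; toℕ-injective; toℕ<n; punchOut-injective; injective⇒≤; any?; ¬∀⟶∃¬; join-splitAt)
  renaming (suc-injective to Fin-suc-injective)
open import Data.Fin.Subset using (Subset)
open import Data.List using (List; []; _∷_; _++_; length; filter; map; tabulate; allFin; cartesianProduct)
open import Data.List.Properties using (filter-++; length-++; map-tabulate)
open import Data.List.Relation.Unary.All using (_∷_)
open import Data.Nat
  using (ℕ; zero; suc; _+_; _*_; _∸_; _^_; _<_; _≤_; z≤n; s≤s; NonZero; >-nonZero; >-nonZero⁻¹; ∣_-_∣
        ; nonTrivial⇒n>1; s<s⁻¹)
open import Data.Nat.Coprimality as Coprime using (Coprime; coprime-divisor)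
open import Data.Nat.Divisibility
open import Data.Nat.DivMod
open import Data.Nat.GCD using (gcd; gcd-GCD; module Bézout; gcd[m,n]∣m; gcd[m,n]∣n)
open import Data.Nat.Induction using (<-wellFounded)
import Data.Nat.ListAction as ListAction
open import Data.Nat.Primality using (Prime; euclidsLemma; prime⇒nonTrivial)
open import Data.Nat.Primality.Factorisation using (factorise)
open import Data.Nat.Properties
open import Data.Nat.Tactic.RingSolver using (solve-∀)
open import Data.Product as Product using (_×_; _,_; ∃; ∃₂; ∃-syntax; proj₁; proj₂)
open import Data.Product.Function.NonDependent.Propositional using (_×-⇔_)
open import Data.Sum as Sum using (_⊎_; inj₁; inj₂; [_,_]′)
open import Function using (_⇔_; mk⇔; Equivalence; id)
open import Function.Construct.Composition using (_⇔-∘_)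
open import Function.Construct.Symmetry using (⇔-sym)
open import Function.Definitions using (Injective)
open import Induction.WellFounded using (Acc; acc)
open import Relation.Binary using (IsEquivalence; Setoid)
open import Relation.Binary.Definitions using (tri<; tri≈; tri>)
open import Relation.Binary.PropositionalEquality
  using (_≡_; _≢_; refl; sym; trans; cong; cong₂; subst; subst₂; module ≡-Reasoning)
import Relation.Binary.Reasoning.Setoid as SetoidReasoning
open import Relation.Nullary using (¬_; Dec; yes; no; does; contradiction; _×-dec_)

open import Defs

module +-Semigroup = CommutativeSemigroupProperties +-commutativeSemigroup
module *-Semigroup = CommutativeSemigroupProperties *-commutativeSemigroup

module Congruence (M : ℕ) .{{_ : NonZero M}} where

  infix 4 _≋_ _≉_ _≋?_

  -- A record rather than an equation between residues, so that both sides can be inferred.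
  record _≋_ (a b : ℕ) : Set where
    constructor ⟨_⟩
    field residue-≡ : a % M ≡ b % M
  open _≋_ public

  _≉_ : ℕ → ℕ → Set
  a ≉ b = ¬ a ≋ b

  ≋-reflexive : ∀ {a b} → a ≡ b → a ≋ b
  ≋-reflexive refl = ⟨ refl ⟩

  ≋-isEquivalence : IsEquivalence _≋_
  ≋-isEquivalence = record
    { refl = ⟨ refl ⟩
    ; sym = λ e → ⟨ sym (residue-≡ e) ⟩
    ; trans = λ e f → ⟨ trans (residue-≡ e) (residue-≡ f) ⟩
    }

  ≋-setoid : Setoid 0ℓ 0ℓ
  ≋-setoid = record { isEquivalence = ≋-isEquivalence }

  open IsEquivalence ≋-isEquivalence public
    using () renaming (refl to ≋-refl; sym to ≋-sym; trans to ≋-trans)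

  module ≋-Reasoning = SetoidReasoning ≋-setoid

  m%M≋m : ∀ a → a % M ≋ a
  m%M≋m a = ⟨ m%n%n≡m%n a M ⟩

  ≋⇒≡ : ∀ {a b} → a < M → b < M → a ≋ b → a ≡ b
  ≋⇒≡ {a} {b} a<M b<M ⟨ e ⟩ = trans (sym (m<n⇒m%n≡m a<M)) (trans e (m<n⇒m%n≡m b<M))

  +-cong : ∀ {a a′ b b′} → a ≋ a′ → b ≋ b′ → a + b ≋ a′ + b′
  +-cong {a} {a′} {b} {b′} ⟨ e ⟩ ⟨ f ⟩ = ⟨ (begin
    (a + b) % M              ≡⟨ %-distribˡ-+ a b M ⟩
    (a % M + b % M) % M      ≡⟨ cong₂ (λ x y → (x + y) % M) e f ⟩
    (a′ % M + b′ % M) % M    ≡⟨ %-distribˡ-+ a′ b′ M ⟨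
    (a′ + b′) % M            ∎) ⟩
    where open ≡-Reasoning

  *-cong : ∀ {a a′ b b′} → a ≋ a′ → b ≋ b′ → a * b ≋ a′ * b′
  *-cong {a} {a′} {b} {b′} ⟨ e ⟩ ⟨ f ⟩ = ⟨ (begin
    (a * b) % M              ≡⟨ %-distribˡ-* a b M ⟩
    (a % M * (b % M)) % M    ≡⟨ cong₂ (λ x y → (x * y) % M) e f ⟩
    (a′ % M * (b′ % M)) % M  ≡⟨ %-distribˡ-* a′ b′ M ⟨
    (a′ * b′) % M            ∎) ⟩
    where open ≡-Reasoning

  +-congˡ : ∀ c {a b} → a ≋ b → c + a ≋ c + b
  +-congˡ c = +-cong (≋-refl {c})

  +-congʳ : ∀ c {a b} → a ≋ b → a + c ≋ b + c
  +-congʳ c e = +-cong e (≋-refl {c})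

  *-congˡ : ∀ c {a b} → a ≋ b → c * a ≋ c * b
  *-congˡ c = *-cong (≋-refl {c})

  ^-cong : ∀ {a a′} k → a ≋ a′ → a ^ k ≋ a′ ^ k
  ^-cong zero    e = ≋-refl
  ^-cong (suc k) e = *-cong e (^-cong k e)

  ≋-*-commutativeMonoid : CommutativeMonoid 0ℓ 0ℓ
  ≋-*-commutativeMonoid = record
    { isCommutativeMonoid = record
      { isMonoid = record
        { isSemigroup = record
          { isMagma = record { isEquivalence = ≋-isEquivalence ; ∙-cong = *-cong }
          ; assoc = λ x y z → ≋-reflexive (*-assoc x y z) }
        ; identity = (λ x → ≋-reflexive (*-identityˡ x)) , (λ x → ≋-reflexive (*-identityʳ x)) }
      ; comm = λ x y → ≋-reflexive (*-comm x y) } }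

  ^-*≋1 : ∀ {x} d k → x ^ d ≋ 1 → x ^ (k * d) ≋ 1
  ^-*≋1 {x} d k x^d≋1 = begin
    x ^ (k * d)    ≡⟨ cong (x ^_) (*-comm k d) ⟩
    x ^ (d * k)    ≡⟨ ^-*-assoc x d k ⟨
    (x ^ d) ^ k    ≈⟨ ^-cong k x^d≋1 ⟩
    1 ^ k          ≡⟨ ^-zeroˡ k ⟩
    1              ∎
    where open ≋-Reasoning

  ^-+-≋1ʳ : ∀ x a {b} → x ^ b ≋ 1 → x ^ (a + b) ≋ x ^ a
  ^-+-≋1ʳ x a {b} x^b≋1 = begin
    x ^ (a + b)    ≡⟨ ^-distribˡ-+-* x a b ⟩
    x ^ a * x ^ b  ≈⟨ *-congˡ (x ^ a) x^b≋1 ⟩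
    x ^ a * 1      ≡⟨ *-identityʳ (x ^ a) ⟩
    x ^ a          ∎
    where open ≋-Reasoning

  ^-%≋ : ∀ {x} d .{{_ : NonZero d}} k → x ^ d ≋ 1 → x ^ (k % d) ≋ x ^ k
  ^-%≋ {x} d k x^d≋1 = begin
    x ^ (k % d)                ≈⟨ ^-+-≋1ʳ x (k % d) (^-*≋1 d (k / d) x^d≋1) ⟨
    x ^ (k % d + k / d * d)    ≡⟨ cong (x ^_) (m≡m%n+[m/n]*n k d) ⟨
    x ^ k                      ∎
    where open ≋-Reasoning

  ≋⇒∣∣-∣ : ∀ {a b} → a ≋ b → M ∣ ∣ a - b ∣
  ≋⇒∣∣-∣ {a} {b} ⟨ e ⟩ = divides ∣ a / M - b / M ∣ (begin
    ∣ a - b ∣                                      ≡⟨ cong₂ ∣_-_∣ (m≡m%n+[m/n]*n a M) (m≡m%n+[m/n]*n b M) ⟩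
    ∣ a % M + a / M * M - b % M + b / M * M ∣      ≡⟨ cong (λ r → ∣ a % M + a / M * M - r + b / M * M ∣) e ⟨
    ∣ a % M + a / M * M - a % M + b / M * M ∣      ≡⟨ ∣m+n-m+o∣≡∣n-o∣ (a % M) _ _ ⟩
    ∣ a / M * M - b / M * M ∣                      ≡⟨ *-distribʳ-∣-∣ M (a / M) (b / M) ⟨
    ∣ a / M - b / M ∣ * M                          ∎)
    where open ≡-Reasoning

  ∣∣-∣⇒≋ : ∀ {a b} → M ∣ ∣ a - b ∣ → a ≋ b
  ∣∣-∣⇒≋ {a} {b} d = [ (λ a≤b → ordered a≤b d)
                      , (λ b≤a → ≋-sym (ordered b≤a (subst (M ∣_) (∣-∣-comm a b) d))) ]′
                      (≤-total a b)
    where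
    ordered : ∀ {a b} → a ≤ b → M ∣ ∣ a - b ∣ → a ≋ b
    ordered {a} {b} a≤b d = ⟨ (begin
      a % M                ≡⟨ %-remove-+ʳ a d ⟨
      (a + ∣ a - b ∣) % M  ≡⟨ cong (λ r → (a + r) % M) (m≤n⇒∣m-n∣≡n∸m a≤b) ⟩
      (a + (b ∸ a)) % M    ≡⟨ cong (_% M) (m+[n∸m]≡n a≤b) ⟩
      b % M                ∎) ⟩
      where open ≡-Reasoning

  +-cancelˡ-≋ : ∀ c {a b} → c + a ≋ c + b → a ≋ b
  +-cancelˡ-≋ c {a} {b} e = ∣∣-∣⇒≋ (subst (M ∣_) (∣m+n-m+o∣≡∣n-o∣ c a b) (≋⇒∣∣-∣ e))

  +-cancelʳ-≋ : ∀ c {a b} → a + c ≋ b + c → a ≋ b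
  +-cancelʳ-≋ c {a} {b} e = +-cancelˡ-≋ c (subst₂ _≋_ (+-comm a c) (+-comm b c) e)

  0%M≡0 : 0 % M ≡ 0
  0%M≡0 = m<n⇒m%n≡m (>-nonZero⁻¹ M)

  M≋0 : M ≋ 0
  M≋0 = ⟨ trans (n%n≡0 M) (sym 0%M≡0) ⟩

  ∣⇒≋0 : ∀ {a} → M ∣ a → a ≋ 0
  ∣⇒≋0 {a} d = ⟨ trans (n∣m⇒m%n≡0 a M d) (sym 0%M≡0) ⟩

  ≉0⇒%≢0 : ∀ {a} → a ≉ 0 → a % M ≢ 0
  ≉0⇒%≢0 a≉0 a%M≡0 = a≉0 ⟨ trans a%M≡0 (sym 0%M≡0) ⟩

  _≋?_ : ∀ a b → Dec (a ≋ b)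
  a ≋? b with a % M ≟ b % M
  ... | yes e = yes ⟨ e ⟩
  ... | no ne = no (λ e → ne (residue-≡ e))

  residue≡⇔≋ : ∀ c (b : Fin M) → (c % M ≡ toℕ b) ⇔ (c ≋ toℕ b)
  residue≡⇔≋ c b = mk⇔ (λ e → ⟨ trans e (sym b%M≡b) ⟩) (λ e → trans (residue-≡ e) b%M≡b)
    where
    b%M≡b : toℕ b % M ≡ toℕ b
    b%M≡b = m<n⇒m%n≡m (toℕ<n b)

  ∸-residue⇔≋ : ∀ {u v} (x : Fin M) → v ≤ M → ((u + (M ∸ v)) % M ≡ toℕ x) ⇔ (u ≋ v + toℕ x)
  ∸-residue⇔≋ {u} {v} x v≤M = mk⇔
    (λ e → begin
      u                      ≈⟨ shifted ⟨
      u + (M ∸ v) + v        ≈⟨ +-congʳ v (to (residue≡⇔≋ _ x) e) ⟩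
      toℕ x + v              ≡⟨ +-comm (toℕ x) v ⟩
      v + toℕ x              ∎)
    (λ e → from (residue≡⇔≋ _ x) (+-cancelʳ-≋ v (begin
      u + (M ∸ v) + v        ≈⟨ shifted ⟩
      u                      ≈⟨ e ⟩
      v + toℕ x              ≡⟨ +-comm v (toℕ x) ⟩
      toℕ x + v              ∎)))
    where
    open ≋-Reasoning
    open Equivalence
    shifted : u + (M ∸ v) + v ≋ u
    shifted = begin
      u + (M ∸ v) + v        ≡⟨ +-assoc u (M ∸ v) v ⟩
      u + (M ∸ v + v)        ≡⟨ cong (u +_) (m∸n+n≡m v≤M) ⟩
      u + M                  ≈⟨ +-congˡ u M≋0 ⟩
      u + 0                  ≡⟨ +-identityʳ u ⟩
      u                      ∎

  +≋0⇒≋+ : ∀ {A B x y} → x + y ≋ 0 → B ≋ A + x → A ≋ B + y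
  +≋0⇒≋+ {A} {B} {x} {y} x+y≋0 B≋A+x = begin
    A              ≡⟨ +-identityʳ A ⟨
    A + 0          ≈⟨ +-congˡ A x+y≋0 ⟨
    A + (x + y)    ≡⟨ +-assoc A x y ⟨
    A + x + y      ≈⟨ +-congʳ y B≋A+x ⟨
    B + y          ∎
    where open ≋-Reasoning

  ≡∸⇒+≋0 : ∀ {u v} → v ≤ M → u ≡ M ∸ v → u + v ≋ 0
  ≡∸⇒+≋0 {u} {v} v≤M u≡M∸v = ≋-trans (≋-reflexive (trans (cong (_+ v) u≡M∸v) (m∸n+n≡m v≤M))) M≋0

  +1≋0⇒*≋1 : ∀ {u} → u + 1 ≋ 0 → u * u ≋ 1
  +1≋0⇒*≋1 {u} u+1≋0 = +-cancelʳ-≋ (u + 1) (begin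
    u * u + (u + 1)        ≡⟨ +-assoc (u * u) u 1 ⟨
    u * u + u + 1          ≡⟨ cong (λ z → u * u + z + 1) (*-identityʳ u) ⟨
    u * u + u * 1 + 1      ≡⟨ cong (_+ 1) (*-distribˡ-+ u u 1) ⟨
    u * (u + 1) + 1        ≈⟨ +-congʳ 1 (*-congˡ u u+1≋0) ⟩
    u * 0 + 1              ≡⟨ cong (_+ 1) (*-zeroʳ u) ⟩
    1 + 0                  ≈⟨ +-congˡ 1 u+1≋0 ⟨
    1 + (u + 1)            ∎)
    where open ≋-Reasoning

  +1≋0⇒^-odd≋ : ∀ {u} k → u + 1 ≋ 0 → u ^ (1 + 2 * k) ≋ u
  +1≋0⇒^-odd≋ {u} k u+1≋0 = begin
    u * u ^ (2 * k)    ≡⟨ cong (u *_) (^-*-assoc u 2 k) ⟨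
    u * (u ^ 2) ^ k    ≡⟨ cong (λ z → u * z ^ k) (cong (u *_) (*-identityʳ u)) ⟩
    u * (u * u) ^ k    ≈⟨ *-congˡ u (^-cong k (+1≋0⇒*≋1 u+1≋0)) ⟩
    u * 1 ^ k          ≡⟨ cong (u *_) (^-zeroˡ k) ⟩
    u * 1              ≡⟨ *-identityʳ u ⟩
    u                  ∎
    where open ≋-Reasoning

  ^-odd≋1⇒+1≉0 : 2 < M → ∀ k {u} → u ^ (1 + 2 * k) ≋ 1 → u + 1 ≉ 0
  ^-odd≋1⇒+1≉0 2<M k {u} u^odd≋1 u+1≋0 = contradiction (≋⇒≡ 2<M (>-nonZero⁻¹ M) 2≋0) (λ ())
    where
    open ≋-Reasoning
    2≋0 : 2 ≋ 0
    2≋0 = begin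
      1 + 1      ≈⟨ +-congʳ 1 (≋-trans (≋-sym u^odd≋1) (+1≋0⇒^-odd≋ k u+1≋0)) ⟩
      u + 1      ≈⟨ u+1≋0 ⟩
      0          ∎

  rotate : ℕ → Fin M → Fin M
  rotate j a = fromℕ< (m%n<n (toℕ a + j) M)

  rotate-≋ : ∀ j a → toℕ (rotate j a) ≋ toℕ a + j
  rotate-≋ j a = ≋-trans (≋-reflexive (toℕ-fromℕ< _)) (m%M≋m (toℕ a + j))

  rotate-injective : ∀ j → Injective _≡_ _≡_ (rotate j)
  rotate-injective j {a} {b} e = toℕ-injective (≋⇒≡ (toℕ<n a) (toℕ<n b) (+-cancelʳ-≋ j (begin
    toℕ a + j           ≈⟨ rotate-≋ j a ⟨
    toℕ (rotate j a)    ≡⟨ cong toℕ e ⟩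
    toℕ (rotate j b)    ≈⟨ rotate-≋ j b ⟩
    toℕ b + j           ∎)))
    where open ≋-Reasoning

  rotate-step : ∀ j s a b →
    ((toℕ (rotate j a) + s) % M ≡ toℕ (rotate j b)) ⇔ ((toℕ a + s) % M ≡ toℕ b)
  rotate-step j s a b = mk⇔
    (λ e → from (residue≡⇔≋ _ b) (+-cancelʳ-≋ j (begin
      toℕ a + s + j           ≡⟨ +-Semigroup.xy∙z≈xz∙y (toℕ a) s j ⟩
      toℕ a + j + s           ≈⟨ +-congʳ s (rotate-≋ j a) ⟨
      toℕ (rotate j a) + s    ≈⟨ to (residue≡⇔≋ _ (rotate j b)) e ⟩
      toℕ (rotate j b)        ≈⟨ rotate-≋ j b ⟩
      toℕ b + j               ∎)))
    (λ e → from (residue≡⇔≋ _ (rotate j b)) (begin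
      toℕ (rotate j a) + s    ≈⟨ +-congʳ s (rotate-≋ j a) ⟩
      toℕ a + j + s           ≡⟨ +-Semigroup.xy∙z≈xz∙y (toℕ a) j s ⟩
      toℕ a + s + j           ≈⟨ +-congʳ j (to (residue≡⇔≋ _ b) e) ⟩
      toℕ b + j               ≈⟨ rotate-≋ j b ⟨
      toℕ (rotate j b)        ∎))
    where
    open ≋-Reasoning
    open Equivalence

  step-irreflexive : ∀ {s} (a : Fin M) → 0 < s → s < M → (toℕ a + s) % M ≢ toℕ a
  step-irreflexive {s} a 0<s s<M e = <⇒≢ 0<s (sym (≋⇒≡ s<M (>-nonZero⁻¹ M) (+-cancelˡ-≋ (toℕ a) (begin
    toℕ a + s    ≈⟨ to (residue≡⇔≋ _ a) e ⟩
    toℕ a        ≡⟨ +-identityʳ (toℕ a) ⟨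
    toℕ a + 0    ∎))))
    where
    open ≋-Reasoning
    open Equivalence

injective⇒surjective : ∀ {k l} (f : Fin k → Fin l) → Injective _≡_ _≡_ f → l ≤ k →
                       ∀ y → ∃ λ x → f x ≡ y
injective⇒surjective {k} {suc l} f f-inj l<k y with any? (λ x → f x Fin.≟ y)
... | yes hit = hit
... | no miss = contradiction (injective⇒≤ avoid-inj) (<⇒≱ l<k)
  where
  f≢y : ∀ x → y ≢ f x
  f≢y x e = miss (x , sym e)
  avoid : Fin k → Fin l
  avoid x = punchOut (f≢y x)
  avoid-inj : Injective _≡_ _≡_ avoid
  avoid-inj e = f-inj (punchOut-injective (f≢y _) (f≢y _) e)

injective⇒permutation : ∀ {k} (f : Fin k → Fin k) → Injective _≡_ _≡_ f → Permutation′ k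
injective⇒permutation f f-inj = permutation f f⁻¹
  (λ y → proj₂ (onto y)) (λ x → f-inj (proj₂ (onto (f x))))
  where
  onto : ∀ y → ∃ λ x → f x ≡ y
  onto = injective⇒surjective f f-inj ≤-refl
  f⁻¹ : Fin _ → Fin _
  f⁻¹ y = proj₁ (onto y)

module ∑ = MonoidSum +-0-commutativeMonoid
open ∑ using (sum)

sum-const : ∀ k c → sum {k} (λ _ → c) ≡ k * c
sum-const zero    c = refl
sum-const (suc k) c = cong (c +_) (sum-const k c)

sum-zero : ∀ {k} (f : Fin k → ℕ) → (∀ i → f i ≡ 0) → sum f ≡ 0
sum-zero {k} f f≡0 = trans (∑.sum-cong-≗ f≡0) (trans (sum-const k 0) (*-zeroʳ k))

sum-permute : ∀ {k} (f : Fin k → ℕ) (σ : Fin k → Fin k) → Injective _≡_ _≡_ σ →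
              sum f ≡ sum (λ i → f (σ i))
sum-permute f σ σ-inj = ∑.∑-permute f (injective⇒permutation σ σ-inj)

indicator : ∀ {a} {A : Set a} → Dec A → ℕ
indicator d = if does d then 1 else 0

module _ {a} {A : Set a} where

  indicator-yes : A → (d : Dec A) → indicator d ≡ 1
  indicator-yes x (yes _) = refl
  indicator-yes x (no ¬x) = contradiction x ¬x

  indicator-no : ¬ A → (d : Dec A) → indicator d ≡ 0
  indicator-no ¬x (yes x) = contradiction x ¬x
  indicator-no ¬x (no _)  = refl

indicator-cong : ∀ {a b} {A : Set a} {B : Set b} → A ⇔ B → (d : Dec A) (e : Dec B) →
                 indicator d ≡ indicator e
indicator-cong A⇔B (yes x) e = sym (indicator-yes (Equivalence.to A⇔B x) e)
indicator-cong A⇔B (no ¬x) e = sym (indicator-no (λ y → ¬x (Equivalence.from A⇔B y)) e)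

sum-indicator-≡ : ∀ {k} v → v < k → sum {k} (λ x → indicator (v ≟ toℕ x)) ≡ 1
sum-indicator-≡ {suc k} zero    _         =
  cong suc (sum-zero {k} _ (λ x → indicator-no (λ ()) (0 ≟ suc (toℕ x))))
sum-indicator-≡ {suc k} (suc v) (s≤s v<k) = sum-indicator-≡ v v<k

module _ {a p} {A : Set a} {P : A → Set p} (P? : ∀ x → Dec (P x)) where

  length-filter-∷ : ∀ x xs → length (filter P? (x ∷ xs)) ≡ indicator (P? x) + length (filter P? xs)
  length-filter-∷ x xs with does (P? x)
  ... | true  = refl
  ... | false = refl

  length-filter-++ : ∀ xs ys → length (filter P? (xs ++ ys)) ≡ length (filter P? xs) + length (filter P? ys)
  length-filter-++ xs ys = trans (cong length (filter-++ P? xs ys)) (length-++ (filter P? xs))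

  length-filter-tabulate : ∀ {k} (g : Fin k → A) →
                           length (filter P? (tabulate g)) ≡ sum (λ i → indicator (P? (g i)))
  length-filter-tabulate {zero}  g = refl
  length-filter-tabulate {suc k} g =
    trans (length-filter-∷ (g Fin.zero) _) (cong (_ +_) (length-filter-tabulate (λ i → g (Fin.suc i))))

module _ {a b p} {A : Set a} {B : Set b} {P : A × B → Set p} (P? : ∀ x → Dec (P x)) where

  length-filter-tabulate² : ∀ {k l} (g : Fin k → A) (h : Fin l → B) →
    length (filter P? (cartesianProduct (tabulate g) (tabulate h)))
      ≡ sum (λ i → sum (λ j → indicator (P? (g i , h j))))
  length-filter-tabulate² {zero}  g h = refl
  length-filter-tabulate² {suc k} g h = begin
    length (filter P? (map (g Fin.zero ,_) (tabulate h) ++ rest))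
      ≡⟨ length-filter-++ P? (map (g Fin.zero ,_) (tabulate h)) rest ⟩
    length (filter P? (map (g Fin.zero ,_) (tabulate h))) + length (filter P? rest)
      ≡⟨ cong₂ _+_ (cong (λ xs → length (filter P? xs)) (map-tabulate h (g Fin.zero ,_)))
                   (length-filter-tabulate² (λ i → g (Fin.suc i)) h) ⟩
    length (filter P? (tabulate (λ j → g Fin.zero , h j))) + later
      ≡⟨ cong (_+ later) (length-filter-tabulate P? (λ j → g Fin.zero , h j)) ⟩
    sum (λ j → indicator (P? (g Fin.zero , h j))) + later
      ∎
    where
    open ≡-Reasoning
    rest : List (A × B)
    rest = cartesianProduct (tabulate (λ i → g (Fin.suc i))) (tabulate h)
    later : ℕ
    later = sum (λ i → sum (λ j → indicator (P? (g (Fin.suc i) , h j))))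

length-filter-allFin² : ∀ {p k l} {P : Fin k × Fin l → Set p} (P? : ∀ x → Dec (P x)) →
  length (filter P? (cartesianProduct (allFin k) (allFin l)))
    ≡ sum (λ i → sum (λ j → indicator (P? (i , j))))
length-filter-allFin² P? = length-filter-tabulate² P? (λ i → i) (λ j → j)

pairCount : ∀ {k r} {R : Fin k → Fin k → Set r} → (∀ a b → Dec (R a b)) → ℕ
pairCount R? = sum (λ a → sum (λ b → indicator (R? a b)))

module _ {k r q} {R : Fin k → Fin k → Set r} {Q : Fin k → Fin k → Set q}
         (R? : ∀ a b → Dec (R a b)) (Q? : ∀ a b → Dec (Q a b)) where

  pairCount-relabel : (σ : Fin k → Fin k) → Injective _≡_ _≡_ σ →
                      (∀ a b → R (σ a) (σ b) ⇔ Q a b) → pairCount R? ≡ pairCount Q?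
  pairCount-relabel σ σ-inj R⇔Q = begin
    sum (λ a → sum (λ b → indicator (R? a b)))
      ≡⟨ ∑.sum-cong-≗ {k} (λ a → sum-permute {k} _ σ σ-inj) ⟩
    sum (λ a → sum (λ b → indicator (R? a (σ b))))
      ≡⟨ sum-permute {k} _ σ σ-inj ⟩
    sum (λ a → sum (λ b → indicator (R? (σ a) (σ b))))
      ≡⟨ ∑.sum-cong-≗ {k} (λ a → ∑.sum-cong-≗ {k} (λ b →
           indicator-cong (R⇔Q a b) (R? (σ a) (σ b)) (Q? a b))) ⟩
    sum (λ a → sum (λ b → indicator (Q? a b)))
      ∎
    where open ≡-Reasoning

  pairCount-transpose : (∀ a b → R b a ⇔ Q a b) → pairCount R? ≡ pairCount Q?
  pairCount-transpose R⇔Q = begin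
    sum (λ a → sum (λ b → indicator (R? a b)))
      ≡⟨ ∑.∑-comm {k} {k} (λ a b → indicator (R? a b)) ⟩
    sum (λ b → sum (λ a → indicator (R? a b)))
      ≡⟨ ∑.sum-cong-≗ {k} (λ b → ∑.sum-cong-≗ {k} (λ a → indicator-cong (R⇔Q b a) (R? a b) (Q? b a))) ⟩
    sum (λ b → sum (λ a → indicator (Q? b a)))
      ∎
    where open ≡-Reasoning

module _ {k r} {R : Fin k → Fin k → Set r} (R? : ∀ a b → Dec (R a b)) where

  sum-pairCount-fibres : ∀ {K} (d : Fin k → Fin k → ℕ) → (∀ a b → d a b < K) →
    sum {K} (λ x → pairCount (λ a b → R? a b ×-dec (d a b ≟ toℕ x))) ≡ pairCount R?
  sum-pairCount-fibres {K} d d<K = begin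
    sum (λ x → sum (λ a → sum (λ b → fibre x a b)))
      ≡⟨ ∑.∑-comm {K} {k} (λ x a → sum (λ b → fibre x a b)) ⟩
    sum (λ a → sum (λ x → sum (λ b → fibre x a b)))
      ≡⟨ ∑.sum-cong-≗ {k} (λ a → ∑.∑-comm {K} {k} (λ x b → fibre x a b)) ⟩
    sum (λ a → sum (λ b → sum (λ x → fibre x a b)))
      ≡⟨ ∑.sum-cong-≗ {k} (λ a → ∑.sum-cong-≗ {k} (λ b → sum-fibre a b (R? a b))) ⟩
    sum (λ a → sum (λ b → indicator (R? a b)))
      ∎
    where
    open ≡-Reasoning
    fibre : Fin K → Fin k → Fin k → ℕ
    fibre x a b = indicator (R? a b ×-dec (d a b ≟ toℕ x))
    sum-fibre : ∀ a b (Rab? : Dec (R a b)) →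
                sum {K} (λ x → indicator (Rab? ×-dec (d a b ≟ toℕ x))) ≡ indicator Rab?
    sum-fibre a b (yes Rab) = trans
      (∑.sum-cong-≗ {K} (λ x →
        indicator-cong (mk⇔ proj₂ (Rab ,_)) (yes Rab ×-dec (d a b ≟ toℕ x)) (d a b ≟ toℕ x)))
      (sum-indicator-≡ {K} (d a b) (d<K a b))
    sum-fibre a b (no ¬Rab) = sum-zero {K} _ (λ x →
      indicator-no (λ z → ¬Rab (proj₁ z)) (no ¬Rab ×-dec (d a b ≟ toℕ x)))

  ordered? : ∀ a b → Dec (toℕ a < toℕ b × R a b)
  ordered? a b = (toℕ a <? toℕ b) ×-dec R? a b

  module _ (R-sym : ∀ {a b} → R a b → R b a) (R-irr : ∀ {a} → ¬ R a a) where

    indicator-split : ∀ a b → indicator (R? a b) ≡ indicator (ordered? a b) + indicator (ordered? b a)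
    indicator-split a b with <-cmp (toℕ a) (toℕ b)
    ... | tri< a<b _ a≯b = begin
      indicator (R? a b)                                  ≡⟨ indicator-cong a<b⇔ (R? a b) (ordered? a b) ⟩
      indicator (ordered? a b)                            ≡⟨ +-identityʳ (indicator (ordered? a b)) ⟨
      indicator (ordered? a b) + 0                        ≡⟨ cong (indicator (ordered? a b) +_) b≮a ⟨
      indicator (ordered? a b) + indicator (ordered? b a) ∎
      where
      open ≡-Reasoning
      a<b⇔ : R a b ⇔ (toℕ a < toℕ b × R a b)
      a<b⇔ = mk⇔ (a<b ,_) proj₂
      b≮a : indicator (ordered? b a) ≡ 0
      b≮a = indicator-no (λ z → a≯b (proj₁ z)) (ordered? b a)
    ... | tri≈ _ a≡b _ = begin
      indicator (R? a b)                                  ≡⟨ indicator-no ¬Rab (R? a b) ⟩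
      0 + 0                                               ≡⟨ cong₂ _+_ a≮b b≮a ⟨
      indicator (ordered? a b) + indicator (ordered? b a) ∎
      where
      open ≡-Reasoning
      ¬Rab : ¬ R a b
      ¬Rab Rab = R-irr (subst (R a) (sym (toℕ-injective a≡b)) Rab)
      a≮b : indicator (ordered? a b) ≡ 0
      a≮b = indicator-no (λ z → <-irrefl a≡b (proj₁ z)) (ordered? a b)
      b≮a : indicator (ordered? b a) ≡ 0
      b≮a = indicator-no (λ z → <-irrefl (sym a≡b) (proj₁ z)) (ordered? b a)
    ... | tri> a≮b _ b<a = begin
      indicator (R? a b)                                  ≡⟨ indicator-cong Rab⇔ (R? a b) (ordered? b a) ⟩
      indicator (ordered? b a)                            ≡⟨ cong (_+ indicator (ordered? b a)) a≮b′ ⟨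
      indicator (ordered? a b) + indicator (ordered? b a) ∎
      where
      open ≡-Reasoning
      Rab⇔ : R a b ⇔ (toℕ b < toℕ a × R b a)
      Rab⇔ = mk⇔ (λ Rab → b<a , R-sym Rab) (λ z → R-sym (proj₂ z))
      a≮b′ : indicator (ordered? a b) ≡ 0
      a≮b′ = indicator-no (λ z → a≮b (proj₁ z)) (ordered? a b)

    pairCount-symmetric : pairCount R? ≡ 2 * pairCount ordered?
    pairCount-symmetric = begin
      sum (λ a → sum (λ b → indicator (R? a b)))
        ≡⟨ ∑.sum-cong-≗ {k} (λ a → ∑.sum-cong-≗ {k} (indicator-split a)) ⟩
      sum (λ a → sum (λ b → indicator (ordered? a b) + indicator (ordered? b a)))
        ≡⟨ ∑.sum-cong-≗ {k} (λ a → ∑.∑-distrib-+ {k} (λ b → indicator (ordered? a b))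
                                                        (λ b → indicator (ordered? b a))) ⟩
      sum (λ a → sum (λ b → indicator (ordered? a b)) + sum (λ b → indicator (ordered? b a)))
        ≡⟨ ∑.∑-distrib-+ {k} (λ a → sum (λ b → indicator (ordered? a b)))
                             (λ a → sum (λ b → indicator (ordered? b a))) ⟩
      pairCount ordered? + pairCount (λ a b → ordered? b a)
        ≡⟨ cong (pairCount ordered? +_) (∑.∑-comm {k} {k} (λ a b → indicator (ordered? a b))) ⟨
      pairCount ordered? + pairCount ordered?
        ≡⟨ cong (pairCount ordered? +_) (+-identityʳ (pairCount ordered?)) ⟨
      2 * pairCount ordered?
        ∎
      where open ≡-Reasoning

^-distribʳ-* : ∀ a b k → (a * b) ^ k ≡ a ^ k * b ^ k
^-distribʳ-* a b zero    = refl
^-distribʳ-* a b (suc k) =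
  trans (cong (a * b *_) (^-distribʳ-* a b k)) (*-Semigroup.interchange a b (a ^ k) (b ^ k))

eval : List ℕ → ℕ → ℕ
eval []       x = 0
eval (c ∷ cs) x = c + x * eval cs x

deflate : ℕ → List ℕ → List ℕ
deflate r []            = []
deflate r (c ∷ [])      = []
deflate r (c ∷ c′ ∷ cs) = eval (c′ ∷ cs) r ∷ deflate r (c′ ∷ cs)

-- P(x) − P(r) = (x − r) · (deflate r P)(x), with both subtractions moved across.
eval-deflate : ∀ r P x → eval P x + r * eval (deflate r P) x ≡ x * eval (deflate r P) x + eval P r
eval-deflate r []       x = trans (*-zeroʳ r) (sym (trans (+-identityʳ (x * 0)) (*-zeroʳ x)))
eval-deflate r (c ∷ []) x = regroup₀ c x r
  where
  regroup₀ : ∀ c x r → c + x * 0 + r * 0 ≡ x * 0 + (c + r * 0)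
  regroup₀ = solve-∀
eval-deflate r (c ∷ c′ ∷ cs) x = begin
  (c + x * A) + r * (B + x * Q)  ≡⟨ regroup c x r A B Q ⟩
  (c + r * B) + x * (A + r * Q)  ≡⟨ cong (λ z → (c + r * B) + x * z) (eval-deflate r (c′ ∷ cs) x) ⟩
  (c + r * B) + x * (x * Q + B)  ≡⟨ regroup′ c x r B Q ⟩
  x * (B + x * Q) + (c + r * B)  ∎
  where
  open ≡-Reasoning
  A B Q : ℕ
  A = eval (c′ ∷ cs) x
  B = eval (c′ ∷ cs) r
  Q = eval (deflate r (c′ ∷ cs)) x
  regroup : ∀ c x r A B Q → (c + x * A) + r * (B + x * Q) ≡ (c + r * B) + x * (A + r * Q)
  regroup = solve-∀
  regroup′ : ∀ c x r B Q → (c + r * B) + x * (x * Q + B) ≡ x * (B + x * Q) + (c + r * B)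
  regroup′ = solve-∀

length-deflate : ∀ r c cs → length (deflate r (c ∷ cs)) ≡ length cs
length-deflate r c []        = refl
length-deflate r c (c′ ∷ cs) = cong suc (length-deflate r c′ cs)

monomial : ℕ → List ℕ
monomial zero    = 1 ∷ []
monomial (suc k) = 0 ∷ monomial k

eval-monomial : ∀ k x → eval (monomial k) x ≡ x ^ k
eval-monomial zero    x = cong suc (*-zeroʳ x)
eval-monomial (suc k) x = cong (x *_) (eval-monomial k x)

length-monomial : ∀ k → length (monomial k) ≡ suc k
length-monomial zero    = refl
length-monomial (suc k) = cong suc (length-monomial k)

∃-prime-divisor : ∀ d → 1 < d → ∃ λ q → Prime q × q ∣ d
∃-prime-divisor d 1<d with factorise d {{>-nonZero (<-trans (s≤s z≤n) 1<d)}}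
... | record { factors = [] ; isFactorisation = d≡1 } = contradiction d≡1 (>⇒≢ 1<d)
... | record { factors = q ∷ qs ; isFactorisation = d≡q*qs ; factorsPrime = q-prime ∷ _ } =
  q , q-prime , divides (ListAction.product qs) (trans d≡q*qs (*-comm q _))

coprime-∣⇒*-∣ : ∀ {r t j} → Coprime r t → r ∣ j → t ∣ j → r * t ∣ j
coprime-∣⇒*-∣ {r} {t} r⊥t (divides j₁ refl) t∣j₁r
  with coprime-divisor (Coprime.sym r⊥t) (subst (t ∣_) (*-comm j₁ r) t∣j₁r)
... | divides j₂ refl = divides j₂ (*-Semigroup.xy∙z≈x∙zy j₂ t r)

module PrimePower (q : ℕ) (q-prime : Prime q) where

  1<q : 1 < q
  1<q = nonTrivial⇒n>1 q {{prime⇒nonTrivial q-prime}}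

  instance
    q-nonZero : NonZero q
    q-nonZero = >-nonZero (<-trans (s≤s z≤n) 1<q)

  divisor-of-power : ∀ e {d c} → d * c ≡ q ^ e → c ≡ 1 ⊎ q ∣ c
  divisor-of-power zero    {d} {c} dc≡1 = inj₁ (m*n≡1⇒n≡1 d c dc≡1)
  divisor-of-power (suc e) {d} {c} dc≡q^e+1
    with euclidsLemma d c q-prime (divides (q ^ e) (trans dc≡q^e+1 (*-comm q (q ^ e))))
  ... | inj₂ q∣c = inj₂ q∣c
  ... | inj₁ (divides d′ refl) = divisor-of-power e {d′} {c} (*-cancelˡ-≡ (d′ * c) (q ^ e) q (begin
    q * (d′ * c)  ≡⟨ *-assoc q d′ c ⟨
    q * d′ * c    ≡⟨ cong (_* c) (*-comm q d′) ⟩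
    d′ * q * c    ≡⟨ dc≡q^e+1 ⟩
    q * q ^ e     ∎))
    where open ≡-Reasoning

  cofactor-bounds : ∀ {d e d′} → 0 < d → d ≡ q ^ suc e * d′ → 0 < d′ × d′ < d
  cofactor-bounds {d} {e} {d′} 0<d d≡Qd′ = 0<d′ , subst (d′ <_) (trans (*-comm d′ Q) (sym d≡Qd′)) d′<d′Q
    where
    Q : ℕ
    Q = q ^ suc e
    0<d′ : 0 < d′
    0<d′ = n≢0⇒n>0 (λ d′≡0 → >⇒≢ 0<d (trans d≡Qd′ (trans (cong (Q *_) d′≡0) (*-zeroʳ Q))))
    d′<d′Q : d′ < d′ * Q
    d′<d′Q = m<m*n d′ Q {{>-nonZero 0<d′}} (^-monoʳ-< q 1<q {0} {suc e} (s≤s z≤n))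

  coprime-power : ∀ {d} e → ¬ q ∣ d → Coprime d (q ^ e)
  coprime-power {d} e q∤d {δ} (δ∣d , divides c q^e≡cδ) with divisor-of-power e {c} {δ} (sym q^e≡cδ)
  ... | inj₁ δ≡1 = δ≡1
  ... | inj₂ q∣δ = contradiction (∣-trans q∣δ δ∣d) q∤d

  split-power : ∀ d → 0 < d → ∃₂ λ e d′ → d ≡ q ^ e * d′ × ¬ q ∣ d′
  split-power d = go d (<-wellFounded d)
    where
    go : ∀ d → Acc _<_ d → 0 < d → ∃₂ λ e d′ → d ≡ q ^ e * d′ × ¬ q ∣ d′
    go d (acc smaller) 0<d with q ∣? d
    ... | no q∤d = 0 , d , sym (*-identityˡ d) , q∤d
    ... | yes (divides d₁ d≡d₁q) with go d₁ (smaller d₁<d) 0<d₁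
      where
      0<d₁ : 0 < d₁
      0<d₁ = n≢0⇒n>0 (λ d₁≡0 → >⇒≢ 0<d (trans d≡d₁q (cong (_* q) d₁≡0)))
      d₁<d : d₁ < d
      d₁<d = subst (d₁ <_) (sym d≡d₁q) (m<m*n d₁ q {{>-nonZero 0<d₁}} 1<q)
    ... | e , d′ , d₁≡q^e*d′ , q∤d′ = suc e , d′ , (begin
      d                  ≡⟨ d≡d₁q ⟩
      d₁ * q             ≡⟨ cong (_* q) d₁≡q^e*d′ ⟩
      q ^ e * d′ * q     ≡⟨ *-Semigroup.xy∙z≈z∙xy (q ^ e) d′ q ⟩
      q * (q ^ e * d′)   ≡⟨ *-assoc q (q ^ e) d′ ⟨
      q ^ suc e * d′     ∎) , q∤d′
      where open ≡-Reasoning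

prime-power-split : ∀ d → 1 < d → ∃ λ q → Prime q × ∃₂ λ e d′ → d ≡ q ^ suc e * d′ × ¬ q ∣ d′
prime-power-split d 1<d with ∃-prime-divisor d 1<d
... | q , q-prime , q∣d with PrimePower.split-power q q-prime d (<-trans (s≤s z≤n) 1<d)
... | zero  , d′ , d≡d′ , q∤d′ = contradiction (subst (q ∣_) (trans d≡d′ (*-identityˡ d′)) q∣d) q∤d′
... | suc e , d′ , d≡q^e*d′ , q∤d′ = q , q-prime , e , d′ , d≡q^e*d′ , q∤d′

module Order (M : ℕ) .{{_ : NonZero M}} where
  open Congruence M

  HasOrder : ℕ → ℕ → Set
  HasOrder x d = x ^ d ≋ 1 × (∀ j → 0 < j → j < d → x ^ j ≉ 1)

  hasOrder⇒∣ : ∀ {x d k} → 0 < d → HasOrder x d → x ^ k ≋ 1 → d ∣ k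
  hasOrder⇒∣ {x} {d@(suc _)} {k} _ (x^d≋1 , minimal) x^k≋1 with k % d ≟ 0
  ... | yes k%d≡0 = m%n≡0⇒n∣m k d k%d≡0
  ... | no  k%d≢0 = contradiction (≋-trans (^-%≋ d k x^d≋1) x^k≋1)
                                  (minimal (k % d) (n≢0⇒n>0 k%d≢0) (m%n<n k d))

  ^-gcd≋1 : ∀ {x a b} → x ^ a ≋ 1 → x ^ b ≋ 1 → x ^ gcd a b ≋ 1
  ^-gcd≋1 {x} {a} {b} x^a≋1 x^b≋1 with Bézout.identity (gcd-GCD a b)
  ... | Bézout.Identity.+- u v gcd+vb≡ua = begin
    x ^ gcd a b              ≈⟨ ^-+-≋1ʳ x (gcd a b) (^-*≋1 b v x^b≋1) ⟨
    x ^ (gcd a b + v * b)    ≡⟨ cong (x ^_) gcd+vb≡ua ⟩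
    x ^ (u * a)              ≈⟨ ^-*≋1 a u x^a≋1 ⟩
    1                        ∎
    where open ≋-Reasoning
  ... | Bézout.Identity.-+ u v gcd+ua≡vb = begin
    x ^ gcd a b              ≈⟨ ^-+-≋1ʳ x (gcd a b) (^-*≋1 a u x^a≋1) ⟨
    x ^ (gcd a b + u * a)    ≡⟨ cong (x ^_) gcd+ua≡vb ⟩
    x ^ (v * b)              ≈⟨ ^-*≋1 b v x^b≋1 ⟩
    1                        ∎
    where open ≋-Reasoning

  -- A proper divisor of q^(e+1) divides q^e, so it cannot kill y.
  hasOrder-prime-power : ∀ {q} → Prime q → ∀ e {y} →
    y ^ (q ^ suc e) ≋ 1 → y ^ (q ^ e) ≉ 1 → HasOrder y (q ^ suc e)
  hasOrder-prime-power {q} q-prime e {y} y^Q≋1 y^q^e≉1 = y^Q≋1 , minimal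
    where
    open PrimePower q q-prime
    Q : ℕ
    Q = q ^ suc e
    minimal : ∀ j → 0 < j → j < Q → y ^ j ≉ 1
    minimal j 0<j j<Q y^j≋1 with gcd[m,n]∣n j Q
    ... | divides c Q≡cG with divisor-of-power (suc e) {gcd j Q} {c} (trans (*-comm _ c) (sym Q≡cG))
    ... | inj₁ refl = <-irrefl refl (≤-<-trans Q≤j j<Q)
      where
      Q≤j : Q ≤ j
      Q≤j = subst (_≤ j) (trans (sym (*-identityˡ _)) (sym Q≡cG)) (∣⇒≤ {{>-nonZero 0<j}} (gcd[m,n]∣m j Q))
    ... | inj₂ (divides c′ refl) = y^q^e≉1 (subst (λ z → y ^ z ≋ 1) (sym q^e≡c′G) (^-*≋1 G c′ y^G≋1))
      where
      G : ℕ
      G = gcd j Q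
      y^G≋1 : y ^ G ≋ 1
      y^G≋1 = ^-gcd≋1 {y} {j} {Q} y^j≋1 y^Q≋1
      q^e≡c′G : q ^ e ≡ c′ * G
      q^e≡c′G = *-cancelˡ-≡ (q ^ e) (c′ * G) q
        (trans Q≡cG (trans (cong (_* G) (*-comm c′ q)) (*-assoc q c′ G)))

  *-^≋1⇒^≋1 : ∀ {x y d k} → x ^ d ≋ 1 → d ∣ k → (x * y) ^ k ≋ 1 → y ^ k ≋ 1
  *-^≋1⇒^≋1 {x} {y} {d} {k} x^d≋1 (divides c refl) xy^k≋1 = begin
    y ^ k            ≡⟨ *-identityˡ (y ^ k) ⟨
    1 * y ^ k        ≈⟨ *-cong (^-*≋1 d c x^d≋1) (≋-refl {y ^ k}) ⟨
    x ^ k * y ^ k    ≡⟨ ^-distribʳ-* x y k ⟨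
    (x * y) ^ k      ≈⟨ xy^k≋1 ⟩
    1                ∎
    where open ≋-Reasoning

  hasOrder-* : ∀ {a b r t} → 0 < r → 0 < t → Coprime r t →
               HasOrder a r → HasOrder b t → HasOrder (a * b) (r * t)
  hasOrder-* {a} {b} {r} {t} 0<r 0<t r⊥t ord-a@(a^r≋1 , _) ord-b@(b^t≋1 , _) = ab^rt≋1 , minimal
    where
    open ≋-Reasoning
    ab^rt≋1 : (a * b) ^ (r * t) ≋ 1
    ab^rt≋1 = begin
      (a * b) ^ (r * t)            ≡⟨ ^-distribʳ-* a b (r * t) ⟩
      a ^ (r * t) * b ^ (r * t)    ≈⟨ *-cong (subst (λ z → a ^ z ≋ 1) (*-comm t r) (^-*≋1 r t a^r≋1))
                                             (^-*≋1 t r b^t≋1) ⟩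
      1                            ∎
    minimal : ∀ j → 0 < j → j < r * t → (a * b) ^ j ≉ 1
    minimal j 0<j j<rt ab^j≋1 = <⇒≱ j<rt (∣⇒≤ {{>-nonZero 0<j}} (coprime-∣⇒*-∣ r⊥t r∣j t∣j))
      where
      t∣j : t ∣ j
      t∣j = coprime-divisor (Coprime.sym r⊥t) (hasOrder⇒∣ 0<t ord-b
              (*-^≋1⇒^≋1 a^r≋1 (divides j (*-comm r j)) (^-*≋1 j r ab^j≋1)))
      r∣j : r ∣ j
      r∣j = coprime-divisor r⊥t (hasOrder⇒∣ 0<r ord-a
              (*-^≋1⇒^≋1 b^t≋1 (divides j (*-comm t j))
                (subst (λ z → z ^ (t * j) ≋ 1) (*-comm a b) (^-*≋1 j t ab^j≋1))))

module PrimeModulus (p : ℕ) .{{_ : NonZero p}} (p-prime : Prime p) where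
  open Congruence p public
  open Order p public

  1<p : 1 < p
  1<p = nonTrivial⇒n>1 p {{prime⇒nonTrivial p-prime}}

  1≉0 : 1 ≉ 0
  1≉0 1≋0 with ≋⇒≡ 1<p (>-nonZero⁻¹ p) 1≋0
  ... | ()

  *≋*⇒≋⊎≋0 : ∀ {a b c} → a * c ≋ b * c → a ≋ b ⊎ c ≋ 0
  *≋*⇒≋⊎≋0 {a} {b} {c} ac≋bc
    with euclidsLemma ∣ a - b ∣ c p-prime (subst (p ∣_) (sym (*-distribʳ-∣-∣ c a b)) (≋⇒∣∣-∣ ac≋bc))
  ... | inj₁ p∣a-b = inj₁ (∣∣-∣⇒≋ p∣a-b)
  ... | inj₂ p∣c   = inj₂ (∣⇒≋0 p∣c)

  *-cancelʳ-≋ : ∀ c {a b} → c ≉ 0 → a * c ≋ b * c → a ≋ b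
  *-cancelʳ-≋ c c≉0 ac≋bc with *≋*⇒≋⊎≋0 ac≋bc
  ... | inj₁ a≋b = a≋b
  ... | inj₂ c≋0 = contradiction c≋0 c≉0

  *-cancelˡ-≋ : ∀ c {a b} → c ≉ 0 → c * a ≋ c * b → a ≋ b
  *-cancelˡ-≋ c {a} {b} c≉0 ca≋cb = *-cancelʳ-≋ c c≉0 (subst₂ _≋_ (*-comm c a) (*-comm c b) ca≋cb)

  *-≉0 : ∀ {a b} → a ≉ 0 → b ≉ 0 → a * b ≉ 0
  *-≉0 {a} {b} a≉0 b≉0 ab≋0 = a≉0 (*-cancelʳ-≋ b b≉0 ab≋0)

  ^-≉0 : ∀ {a} k → a ≉ 0 → a ^ k ≉ 0
  ^-≉0 zero    a≉0 = 1≉0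
  ^-≉0 (suc k) a≉0 = *-≉0 a≉0 (^-≉0 k a≉0)

  p-1 : ℕ
  p-1 = p ∸ 1

  unit : Fin p-1 → ℕ
  unit i = suc (toℕ i)

  unit<p : ∀ i → unit i < p
  unit<p i = subst (suc (toℕ i) <_) (m+[n∸m]≡n (<⇒≤ 1<p)) (s≤s (toℕ<n i))

  unit≉0 : ∀ i → unit i ≉ 0
  unit≉0 i unit≋0 with ≋⇒≡ (unit<p i) (>-nonZero⁻¹ p) unit≋0
  ... | ()

  unit-injective : ∀ {i j} → unit i ≋ unit j → i ≡ j
  unit-injective {i} {j} e = toℕ-injective (suc-injective (≋⇒≡ (unit<p i) (unit<p j) e))

  unit-surjective : ∀ {x} → x < p → x ≢ 0 → ∃ λ i → unit i ≡ x
  unit-surjective {zero}  _   x≢0 = contradiction refl x≢0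
  unit-surjective {suc x} x<p _   = fromℕ< x<p-1 , cong suc (toℕ-fromℕ< x<p-1)
    where
    x<p-1 : x < p-1
    x<p-1 = s<s⁻¹ (subst (suc x <_) (sym (m+[n∸m]≡n (<⇒≤ 1<p))) x<p)

  open MonoidSum ≋-*-commutativeMonoid
    using () renaming (sum to ∏; ∑-permute to ∏-permute; sum-cong-≋ to ∏-cong-≋)

  ∏-scale : ∀ {k} a (f : Fin k → ℕ) → ∏ (λ i → a * f i) ≡ a ^ k * ∏ f
  ∏-scale {zero}  a f = refl
  ∏-scale {suc k} a f = trans (cong (a * f Fin.zero *_) (∏-scale a (λ i → f (Fin.suc i))))
                              (*-Semigroup.interchange a (f Fin.zero) (a ^ k) _)

  ∏-≉0 : ∀ {k} (f : Fin k → ℕ) → (∀ i → f i ≉ 0) → ∏ f ≉ 0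
  ∏-≉0 {zero}  f f≉0 = 1≉0
  ∏-≉0 {suc k} f f≉0 = *-≉0 (f≉0 Fin.zero) (∏-≉0 (λ i → f (Fin.suc i)) (λ i → f≉0 (Fin.suc i)))

  -- Multiplication by a permutes the units, so it does not change their product.
  fermat : ∀ {a} → a ≉ 0 → a ^ p-1 ≋ 1
  fermat {a} a≉0 = *-cancelʳ-≋ (∏ unit) (∏-≉0 unit unit≉0) (begin
    a ^ p-1 * ∏ unit         ≡⟨ ∏-scale a unit ⟨
    ∏ (λ i → a * unit i)     ≈⟨ ∏-cong-≋ π≋ ⟨
    ∏ (λ i → unit (π i))     ≈⟨ ∏-permute unit (injective⇒permutation π π-injective) ⟨
    ∏ unit                   ≡⟨ *-identityˡ (∏ unit) ⟨
    1 * ∏ unit               ∎)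
    where
    open ≋-Reasoning
    scaled : ∀ i → ∃ λ j → unit j ≡ (a * unit i) % p
    scaled i = unit-surjective (m%n<n _ p) (≉0⇒%≢0 (*-≉0 a≉0 (unit≉0 i)))
    π : Fin p-1 → Fin p-1
    π i = proj₁ (scaled i)
    π≋ : ∀ i → unit (π i) ≋ a * unit i
    π≋ i = ≋-trans (≋-reflexive (proj₂ (scaled i))) (m%M≋m _)
    π-injective : Injective _≡_ _≡_ π
    π-injective {i} {j} πi≡πj = unit-injective (*-cancelˡ-≋ a a≉0 (begin
      a * unit i      ≈⟨ π≋ i ⟨
      unit (π i)      ≡⟨ cong unit πi≡πj ⟩
      unit (π j)      ≈⟨ π≋ j ⟩
      a * unit j      ∎))

  eval-deflate-root : ∀ r P x → eval P r ≋ 0 →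
                      eval P x + r * eval (deflate r P) x ≋ x * eval (deflate r P) x
  eval-deflate-root r P x P[r]≋0 = begin
    eval P x + r * Q           ≡⟨ eval-deflate r P x ⟩
    x * Q + eval P r           ≈⟨ +-congˡ (x * Q) P[r]≋0 ⟩
    x * Q + 0                  ≡⟨ +-identityʳ (x * Q) ⟩
    x * Q                      ∎
    where
    open ≋-Reasoning
    Q = eval (deflate r P) x

  -- Dividing out the root pt 0 leaves a polynomial with the remaining roots.
  roots⇒≋0 : ∀ k (pt : Fin k → ℕ) → (∀ {i j} → pt i ≋ pt j → i ≡ j) → ∀ P → length P ≤ k →
             (∀ i → eval P (pt i) ≋ 0) → ∀ x → eval P x ≋ 0
  roots⇒≋0 k       pt pt-inj []           _           _     x = ≋-refl
  roots⇒≋0 (suc k) pt pt-inj P@(c ∷ cs) (s≤s |cs|≤k) roots x = begin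
    eval P x                   ≡⟨ +-identityʳ (eval P x) ⟨
    eval P x + 0               ≡⟨ cong (eval P x +_) (*-zeroʳ r) ⟨
    eval P x + r * 0           ≈⟨ +-congˡ (eval P x) (*-congˡ r (Q≋0 x)) ⟨
    eval P x + r * Q[ x ]      ≈⟨ eval-deflate-root r P x (roots Fin.zero) ⟩
    x * Q[ x ]                 ≈⟨ *-congˡ x (Q≋0 x) ⟩
    x * 0                      ≡⟨ *-zeroʳ x ⟩
    0                          ∎
    where
    open ≋-Reasoning
    r : ℕ
    r = pt Fin.zero
    Q[_] : ℕ → ℕ
    Q[ y ] = eval (deflate r P) y
    Q-roots : ∀ i → Q[ pt (Fin.suc i) ] ≋ 0
    Q-roots i with *≋*⇒≋⊎≋0 {r} {y} {Q[ y ]} (begin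
        r * Q[ y ]                 ≈⟨ +-congʳ (r * Q[ y ]) (roots (Fin.suc i)) ⟨
        eval P y + r * Q[ y ]      ≈⟨ eval-deflate-root r P y (roots Fin.zero) ⟩
        y * Q[ y ]                 ∎)
      where
      y : ℕ
      y = pt (Fin.suc i)
    ... | inj₁ r≋y = contradiction (pt-inj r≋y) (λ ())
    ... | inj₂ Q[y]≋0 = Q[y]≋0
    Q≋0 : ∀ z → Q[ z ] ≋ 0
    Q≋0 = roots⇒≋0 k (λ i → pt (Fin.suc i)) (λ e → Fin-suc-injective (pt-inj e)) (deflate r P)
            (subst (_≤ k) (sym (length-deflate r c cs)) |cs|≤k) Q-roots

  p-1≉0 : p-1 ≉ 0
  p-1≉0 p-1≋0 = <⇒≢ (m<n⇒0<n∸m 1<p) (sym (≋⇒≡ p-1<p (>-nonZero⁻¹ p) p-1≋0))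
    where
    p-1<p : p-1 < p
    p-1<p = ∸-monoʳ-< {p} {1} {0} (s≤s z≤n) (<⇒≤ 1<p)

  -- Every unit would be a root of X^(k+1) + (p − 1), which has only k + 2 coefficients.
  ¬-all-units-^≋1 : ∀ k → suc k < p-1 → ¬ (∀ i → unit i ^ suc k ≋ 1)
  ¬-all-units-^≋1 k k<p-1 all≋1 = p-1≉0 (≋-trans (≋-reflexive (sym (+-identityʳ p-1)))
    (roots⇒≋0 p-1 unit unit-injective P (subst (_≤ p-1) (sym (cong suc (length-monomial k))) k<p-1)
      roots 0))
    where
    open ≋-Reasoning
    P : List ℕ
    P = p-1 ∷ monomial k
    roots : ∀ i → eval P (unit i) ≋ 0
    roots i = begin
      p-1 + unit i * eval (monomial k) (unit i)   ≡⟨ cong (λ z → p-1 + unit i * z) (eval-monomial k (unit i)) ⟩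
      p-1 + unit i ^ suc k                        ≈⟨ +-congˡ p-1 (all≋1 i) ⟩
      p-1 + 1                                     ≡⟨ m∸n+n≡m (<⇒≤ 1<p) ⟩
      p                                           ≈⟨ M≋0 ⟩
      0                                           ∎

  ∃-^≉1 : ∀ k → 0 < k → k < p-1 → ∃ λ x → x ≉ 0 × x ^ k ≉ 1
  ∃-^≉1 (suc k) _ k<p-1 with ¬∀⟶∃¬ p-1 (λ i → unit i ^ suc k ≋ 1) (λ i → unit i ^ suc k ≋? 1)
                                       (¬-all-units-^≋1 k k<p-1)
  ... | i , unit^k≉1 = unit i , unit≉0 i , unit^k≉1

  ^-hasOrder-prime-power : ∀ {q} → Prime q → ∀ e {R x} → p-1 ≡ R * q ^ suc e →
                           x ≉ 0 → x ^ (q ^ e * R) ≉ 1 → HasOrder (x ^ R) (q ^ suc e)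
  ^-hasOrder-prime-power {q} q-prime e {R} {x} p-1≡RQ x≉0 x^k≉1 =
    hasOrder-prime-power q-prime e y^Q≋1 y^q^e≉1
    where
    open ≋-Reasoning
    y^Q≋1 : (x ^ R) ^ (q ^ suc e) ≋ 1
    y^Q≋1 = begin
      (x ^ R) ^ (q ^ suc e)   ≡⟨ ^-*-assoc x R (q ^ suc e) ⟩
      x ^ (R * q ^ suc e)     ≡⟨ cong (x ^_) p-1≡RQ ⟨
      x ^ p-1                 ≈⟨ fermat x≉0 ⟩
      1                       ∎
    y^q^e≉1 : (x ^ R) ^ (q ^ e) ≉ 1
    y^q^e≉1 y^q^e≋1 = x^k≉1 (begin
      x ^ (q ^ e * R)         ≡⟨ cong (x ^_) (*-comm (q ^ e) R) ⟩
      x ^ (R * q ^ e)         ≡⟨ ^-*-assoc x R (q ^ e) ⟨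
      (x ^ R) ^ (q ^ e)       ≈⟨ y^q^e≋1 ⟩
      1                       ∎)

  ∃-hasOrder-prime-power : ∀ {q} → Prime q → ∀ e → q ^ suc e ∣ p-1 → ∃ λ y → HasOrder y (q ^ suc e)
  ∃-hasOrder-prime-power {q} q-prime e (divides R p-1≡RQ) = from-nonroot (∃-^≉1 k 0<k k<p-1)
    where
    open PrimePower q q-prime using (1<q)
    k : ℕ
    k = q ^ e * R
    p-1≡qk : p-1 ≡ q * k
    p-1≡qk = trans p-1≡RQ (trans (*-comm R (q * q ^ e)) (*-assoc q (q ^ e) R))
    0<k : 0 < k
    0<k = n≢0⇒n>0 (λ k≡0 → p-1≉0 (≋-reflexive (trans p-1≡qk (trans (cong (q *_) k≡0) (*-zeroʳ q)))))
    k<p-1 : k < p-1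
    k<p-1 = subst (k <_) (trans (*-comm k q) (sym p-1≡qk)) (m<m*n k q {{>-nonZero 0<k}} 1<q)
    from-nonroot : (∃ λ x → x ≉ 0 × x ^ k ≉ 1) → ∃ λ y → HasOrder y (q ^ suc e)
    from-nonroot (x , x≉0 , x^k≉1) = x ^ R , ^-hasOrder-prime-power q-prime e p-1≡RQ x≉0 x^k≉1

  -- Split d = q^(e+1) · d′ with q ∤ d′ and multiply elements of the two coprime orders.
  ∃-hasOrder : ∀ d → 0 < d → d ∣ p-1 → ∃ λ x → HasOrder x d
  ∃-hasOrder d = go d (<-wellFounded d)
    where
    go : ∀ d → Acc _<_ d → 0 < d → d ∣ p-1 → ∃ λ x → HasOrder x d
    go (suc zero)        _             _   _     = 1 , ≋-refl , λ { j 0<j (s≤s j≤0) → contradiction j≤0 (<⇒≱ 0<j) }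
    go d@(suc (suc d-2)) (acc smaller) 0<d d∣p-1 = from-split (prime-power-split d (s≤s (s≤s z≤n)))
      where
      from-split : (∃ λ q → Prime q × ∃₂ λ e d′ → d ≡ q ^ suc e * d′ × ¬ q ∣ d′) → ∃ λ x → HasOrder x d
      from-split (q , q-prime , e , d′ , d≡Qd′ , q∤d′) =
        subst (λ d → ∃ λ x → HasOrder x d) (sym (trans d≡Qd′ (*-comm (q ^ suc e) d′)))
          (combine (go d′ (smaller d′<d) 0<d′ (∣-trans (divides (q ^ suc e) d≡Qd′) d∣p-1))
                   (∃-hasOrder-prime-power q-prime e
                     (∣-trans (divides d′ (trans d≡Qd′ (*-comm (q ^ suc e) d′))) d∣p-1)))
        where
        open PrimePower q q-prime using (q-nonZero; cofactor-bounds; coprime-power)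
        0<d′ : 0 < d′
        0<d′ = proj₁ (cofactor-bounds {e = e} 0<d d≡Qd′)
        d′<d : d′ < d
        d′<d = proj₂ (cofactor-bounds {e = e} 0<d d≡Qd′)
        combine : ∃ (λ c → HasOrder c d′) → ∃ (λ y → HasOrder y (q ^ suc e)) →
                  ∃ λ x → HasOrder x (d′ * q ^ suc e)
        combine (c , c-order) (y , y-order) =
          c * y , hasOrder-* 0<d′ (m^n>0 q (suc e)) (coprime-power (suc e) q∤d′) c-order y-order

  ≋+-scale⇔ : ∀ {c A A′ B B′ x y} → c ≉ 0 → A′ ≋ c * A → B′ ≋ c * B → x ≋ c * y →
              (A′ ≋ B′ + x) ⇔ (A ≋ B + y)
  ≋+-scale⇔ {c} {A} {A′} {B} {B′} {x} {y} c≉0 A′≋cA B′≋cB x≋cy = mk⇔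
    (λ e → *-cancelˡ-≋ c c≉0 (begin
      c * A              ≈⟨ A′≋cA ⟨
      A′                 ≈⟨ e ⟩
      B′ + x             ≈⟨ +-cong B′≋cB x≋cy ⟩
      c * B + c * y      ≡⟨ *-distribˡ-+ c B y ⟨
      c * (B + y)        ∎))
    (λ e → begin
      A′                 ≈⟨ A′≋cA ⟩
      c * A              ≈⟨ *-congˡ c e ⟩
      c * (B + y)        ≡⟨ *-distribˡ-+ c B y ⟩
      c * B + c * y      ≈⟨ +-cong B′≋cB x≋cy ⟨
      B′ + x             ∎)
    where open ≋-Reasoning

module PaleyLabelling (n : ℕ) (p-prime : Prime (3 + 4 * n)) where

  p m : ℕ
  p = 3 + 4 * n
  m = 1 + 2 * n

  open PrimeModulus p p-prime

  p-1≡m+m : p-1 ≡ m + m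
  p-1≡m+m = identity n
    where
    identity : ∀ n → 2 + 4 * n ≡ (1 + 2 * n) + (1 + 2 * n)
    identity = solve-∀

  generator : ∃ λ h → HasOrder h m
  generator = ∃-hasOrder m (s≤s z≤n) (divides 2 (trans p-1≡m+m (cong (m +_) (sym (+-identityʳ m)))))

  h : ℕ
  h = proj₁ generator

  h^m≋1 : h ^ m ≋ 1
  h^m≋1 = proj₁ (proj₂ generator)

  h≉0 : h ≉ 0
  h≉0 h≋0 = 1≉0 (≋-trans (≋-sym h^m≋1) (^-cong m h≋0))

  h^-distinct : ∀ {a b} → a < b → b < m → h ^ a ≉ h ^ b
  h^-distinct {a} {b} a<b b<m h^a≋h^b =
    proj₂ (proj₂ generator) (b ∸ a) (m<n⇒0<n∸m a<b) (≤-<-trans (m∸n≤m b a) b<m)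
      (*-cancelˡ-≋ (h ^ a) (^-≉0 a h≉0) (begin
        h ^ a * h ^ (b ∸ a)  ≡⟨ ^-distribˡ-+-* h a (b ∸ a) ⟨
        h ^ (a + (b ∸ a))    ≡⟨ cong (h ^_) (m+[n∸m]≡n (<⇒≤ a<b)) ⟩
        h ^ b                ≈⟨ h^a≋h^b ⟨
        h ^ a                ≡⟨ *-identityʳ (h ^ a) ⟨
        h ^ a * 1            ∎))
    where open ≋-Reasoning

  h^-injective : ∀ {a b} → a < m → b < m → h ^ a ≋ h ^ b → a ≡ b
  h^-injective {a} {b} a<m b<m h^a≋h^b with <-cmp a b
  ... | tri< a<b _ _ = contradiction h^a≋h^b (h^-distinct a<b b<m)
  ... | tri≈ _ a≡b _ = a≡b
  ... | tri> _ _ b<a = contradiction (≋-sym h^a≋h^b) (h^-distinct b<a a<m)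

  -- h^(2nb) inverts h^b, so h^a + h^b ≡ 0 would make the power h^a · h^(2nb) of h equal to −1,
  -- which is impossible as m is odd.
  h^+h^≉0 : ∀ a b → h ^ a + h ^ b ≉ 0
  h^+h^≉0 a b h^a+h^b≋0 = ^-odd≋1⇒+1≉0 (s≤s (s≤s (s≤s z≤n))) n u^m≋1 u+1≋0
    where
    open ≋-Reasoning
    c u : ℕ
    c = 2 * n * b
    u = h ^ a * h ^ c
    h^b*h^c≋1 : h ^ b * h ^ c ≋ 1
    h^b*h^c≋1 = begin
      h ^ b * h ^ c        ≡⟨ ^-distribˡ-+-* h b c ⟨
      h ^ (m * b)          ≡⟨ cong (h ^_) (*-comm m b) ⟩
      h ^ (b * m)          ≈⟨ ^-*≋1 m b h^m≋1 ⟩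
      1                    ∎
    u+1≋0 : u + 1 ≋ 0
    u+1≋0 = begin
      h ^ a * h ^ c + 1              ≈⟨ +-congˡ u h^b*h^c≋1 ⟨
      h ^ a * h ^ c + h ^ b * h ^ c  ≡⟨ *-distribʳ-+ (h ^ c) (h ^ a) (h ^ b) ⟨
      (h ^ a + h ^ b) * h ^ c        ≈⟨ *-cong h^a+h^b≋0 (≋-refl {h ^ c}) ⟩
      0                              ∎
    u^m≋1 : u ^ m ≋ 1
    u^m≋1 = begin
      (h ^ a * h ^ c) ^ m   ≡⟨ cong (_^ m) (^-distribˡ-+-* h a c) ⟨
      (h ^ (a + c)) ^ m     ≡⟨ ^-*-assoc h (a + c) m ⟩
      h ^ ((a + c) * m)     ≈⟨ ^-*≋1 m (a + c) h^m≋1 ⟩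
      1                     ∎

  f : Fin m → Fin p
  f a = fromℕ< (m%n<n (h ^ toℕ a) p)

  f≋ : ∀ a → toℕ (f a) ≋ h ^ toℕ a
  f≋ a = ≋-trans (≋-reflexive (toℕ-fromℕ< _)) (m%M≋m (h ^ toℕ a))

  f-injective : Injective _≡_ _≡_ f
  f-injective {a} {b} fa≡fb = toℕ-injective (h^-injective (toℕ<n a) (toℕ<n b)
    (≋-trans (≋-sym (f≋ a)) (≋-trans (≋-reflexive (cong toℕ fa≡fb)) (f≋ b))))

  -- h^a is the square of h^(a(n+1)), because 2(n + 1) = m + 1 and h^m = 1.
  f-square : ∀ a → IsNonzeroSquare p (f a)
  f-square a = fa≢0 , fromℕ< (m%n<n r p) , (begin
      (toℕ (fromℕ< (m%n<n r p)) * toℕ (fromℕ< (m%n<n r p))) % p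
        ≡⟨ cong (λ z → (z * z) % p) (toℕ-fromℕ< (m%n<n r p)) ⟩
      (r % p * (r % p)) % p      ≡⟨ residue-≡ (*-cong (m%M≋m r) (m%M≋m r)) ⟩
      (r * r) % p                ≡⟨ residue-≡ r*r≋h^a ⟩
      (h ^ toℕ a) % p            ≡⟨ toℕ-fromℕ< _ ⟨
      toℕ (f a)                  ∎)
    where
    r : ℕ
    r = h ^ (toℕ a * (n + 1))
    fa≢0 : toℕ (f a) ≢ 0
    fa≢0 fa≡0 = ^-≉0 (toℕ a) h≉0 (≋-trans (≋-sym (f≋ a)) (≋-reflexive fa≡0))
    twice : ∀ a n → a * (n + 1) + a * (n + 1) ≡ a + a * (1 + 2 * n)
    twice = solve-∀
    r*r≋h^a : r * r ≋ h ^ toℕ a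
    r*r≋h^a = begin
      r * r                             ≡⟨ ^-distribˡ-+-* h (toℕ a * (n + 1)) (toℕ a * (n + 1)) ⟨
      h ^ (toℕ a * (n + 1) + toℕ a * (n + 1))  ≡⟨ cong (h ^_) (twice (toℕ a) n) ⟩
      h ^ (toℕ a + toℕ a * m)           ≈⟨ ^-+-≋1ʳ h (toℕ a) (^-*≋1 m (toℕ a) h^m≋1) ⟩
      h ^ toℕ a                         ∎
      where open ≋-Reasoning
    open ≡-Reasoning

  signedPower : Fin m ⊎ Fin m → ℕ
  signedPower (inj₁ i) = h ^ toℕ i % p
  signedPower (inj₂ i) = p ∸ h ^ toℕ i % p

  h^%p≢0 : ∀ k → h ^ k % p ≢ 0
  h^%p≢0 k = ≉0⇒%≢0 (^-≉0 k h≉0)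

  signedPower<p : ∀ s → signedPower s < p
  signedPower<p (inj₁ i) = m%n<n (h ^ toℕ i) p
  signedPower<p (inj₂ i) = ∸-monoʳ-< (n≢0⇒n>0 (h^%p≢0 (toℕ i))) (<⇒≤ (m%n<n (h ^ toℕ i) p))

  signedPower≢0 : ∀ s → signedPower s ≢ 0
  signedPower≢0 (inj₁ i) = h^%p≢0 (toℕ i)
  signedPower≢0 (inj₂ i) p∸h^i≡0 = <⇒≱ (m%n<n (h ^ toℕ i) p) (m∸n≡0⇒m≤n p∸h^i≡0)

  ≡p∸⇒+h^≋0 : ∀ {x} i → x ≡ p ∸ h ^ i % p → x + h ^ i ≋ 0
  ≡p∸⇒+h^≋0 {x} i x≡p∸h^i =
    ≋-trans (+-congˡ x (≋-sym (m%M≋m (h ^ i)))) (≡∸⇒+≋0 (<⇒≤ (m%n<n (h ^ i) p)) x≡p∸h^i)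

  power≢negatedPower : ∀ i j → h ^ i % p ≢ p ∸ h ^ j % p
  power≢negatedPower i j e =
    h^+h^≉0 i j (≋-trans (+-congʳ (h ^ j) (≋-sym (m%M≋m (h ^ i)))) (≡p∸⇒+h^≋0 j e))

  signedPower-injective : ∀ {s t} → signedPower s ≡ signedPower t → s ≡ t
  signedPower-injective {inj₁ i} {inj₁ j} e =
    cong inj₁ (toℕ-injective (h^-injective (toℕ<n i) (toℕ<n j) ⟨ e ⟩))
  signedPower-injective {inj₁ i} {inj₂ j} e = contradiction e (power≢negatedPower (toℕ i) (toℕ j))
  signedPower-injective {inj₂ i} {inj₁ j} e = contradiction (sym e) (power≢negatedPower (toℕ j) (toℕ i))
  signedPower-injective {inj₂ i} {inj₂ j} e = cong inj₂ (toℕ-injective (h^-injective (toℕ<n i) (toℕ<n j)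
    ⟨ ∸-cancelˡ-≡ (<⇒≤ (m%n<n (h ^ toℕ i) p)) (<⇒≤ (m%n<n (h ^ toℕ j) p)) e ⟩))

  signedPowerIndex : Fin (m + m) → Fin p-1
  signedPowerIndex i = proj₁ (unit-surjective (signedPower<p (splitAt m i)) (signedPower≢0 (splitAt m i)))

  unit-signedPowerIndex : ∀ i → unit (signedPowerIndex i) ≡ signedPower (splitAt m i)
  unit-signedPowerIndex i = proj₂ (unit-surjective (signedPower<p (splitAt m i)) (signedPower≢0 (splitAt m i)))

  signedPowerIndex-injective : Injective _≡_ _≡_ signedPowerIndex
  signedPowerIndex-injective {i} {j} e = begin
    i                       ≡⟨ join-splitAt m m i ⟨
    join m m (splitAt m i)  ≡⟨ cong (join m m) (signedPower-injective {splitAt m i} {splitAt m j} (begin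
      signedPower (splitAt m i)        ≡⟨ unit-signedPowerIndex i ⟨
      unit (signedPowerIndex i)        ≡⟨ cong unit e ⟩
      unit (signedPowerIndex j)        ≡⟨ unit-signedPowerIndex j ⟩
      signedPower (splitAt m j)        ∎)) ⟩
    join m m (splitAt m j)  ≡⟨ join-splitAt m m j ⟩
    j                       ∎
    where open ≡-Reasoning

  signedPower-cases : ∀ {x} s → signedPower s ≡ x → ∃ λ j → x ≋ h ^ j ⊎ x + h ^ j ≋ 0
  signedPower-cases (inj₁ j) h^j≡x   = toℕ j , inj₁ (≋-trans (≋-reflexive (sym h^j≡x)) (m%M≋m (h ^ toℕ j)))
  signedPower-cases (inj₂ j) p∸h^j≡x = toℕ j , inj₂ (≡p∸⇒+h^≋0 (toℕ j) (sym p∸h^j≡x))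

  -- The 2m = p − 1 distinct units ±h^i exhaust all units.
  power-or-negatedPower : ∀ (x : Fin p) → toℕ x ≢ 0 → ∃ λ j → toℕ x ≋ h ^ j ⊎ toℕ x + h ^ j ≋ 0
  power-or-negatedPower x x≢0 = from-unit (unit-surjective (toℕ<n x) x≢0)
    where
    from-unit : (∃ λ k → unit k ≡ toℕ x) → ∃ λ j → toℕ x ≋ h ^ j ⊎ toℕ x + h ^ j ≋ 0
    from-unit (k , unit-k≡x)
      with injective⇒surjective signedPowerIndex signedPowerIndex-injective (≤-reflexive p-1≡m+m) k
    ... | i , index-i≡k = signedPower-cases (splitAt m i)
      (trans (sym (unit-signedPowerIndex i)) (trans (cong unit index-i≡k) unit-k≡x))

  module DifferenceCounts (S : Subset n) where

    module ℤm = Congruence m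

    Adj : Fin m → Fin m → Set
    Adj = CircAdj m n S

    adj-sym : ∀ {a b} → Adj a b → Adj b a
    adj-sym (i , i∈S , step) = i , i∈S , Sum.swap step

    adj-irreflexive : ∀ {a} → ¬ Adj a a
    adj-irreflexive {a} (i , _ , step) =
      ℤm.step-irreflexive a (s≤s z≤n) (s≤s (≤-trans (toℕ<n i) (m≤m+n n (n + 0)))) ([ id , id ]′ step)

    adj-rotate : ∀ j a b → Adj (ℤm.rotate j a) (ℤm.rotate j b) ⇔ Adj a b
    adj-rotate j a b = mk⇔
      (Product.map₂ (λ {i} → Product.map₂ (Sum.map (to (ℤm.rotate-step j (suc (toℕ i)) a b))
                                                     (to (ℤm.rotate-step j (suc (toℕ i)) b a)))))
      (Product.map₂ (λ {i} → Product.map₂ (Sum.map (from (ℤm.rotate-step j (suc (toℕ i)) a b))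
                                                     (from (ℤm.rotate-step j (suc (toℕ i)) b a)))))
      where open Equivalence

    diff≡⇔ : ∀ x a b → (diffMod p (f a) (f b) ≡ toℕ x) ⇔ (h ^ toℕ a ≋ h ^ toℕ b + toℕ x)
    diff≡⇔ x a b = mk⇔
      (λ e → ≋-trans (≋-sym (f≋ a)) (≋-trans (to (∸-residue⇔≋ x fb≤p) e) (+-congʳ (toℕ x) (f≋ b))))
      (λ e → from (∸-residue⇔≋ x fb≤p) (≋-trans (f≋ a) (≋-trans e (+-congʳ (toℕ x) (≋-sym (f≋ b))))))
      where
      open Equivalence
      fb≤p : toℕ (f b) ≤ p
      fb≤p = <⇒≤ (toℕ<n (f b))

    diffPair? : ∀ (x : Fin p) a b → Dec (Adj a b × diffMod p (f a) (f b) ≡ toℕ x)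
    diffPair? x a b = circAdj? m n S a b ×-dec (diffMod p (f a) (f b) ≟ toℕ x)

    count : Fin p → ℕ
    count x = pairCount (diffPair? x)

    h^-rotate : ∀ j a → h ^ toℕ (ℤm.rotate j a) ≋ h ^ j * h ^ toℕ a
    h^-rotate j a = begin
      h ^ toℕ (ℤm.rotate j a)     ≡⟨ cong (h ^_) (toℕ-fromℕ< (m%n<n (toℕ a + j) m)) ⟩
      h ^ ((toℕ a + j) % m)       ≈⟨ ^-%≋ m (toℕ a + j) h^m≋1 ⟩
      h ^ (toℕ a + j)             ≡⟨ ^-distribˡ-+-* h (toℕ a) j ⟩
      h ^ toℕ a * h ^ j           ≡⟨ *-comm (h ^ toℕ a) (h ^ j) ⟩
      h ^ j * h ^ toℕ a           ∎
      where open ≋-Reasoning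

    -- Rotating the circulant graph by j multiplies every label difference by h^j.
    count-scale : ∀ j x y → toℕ x ≋ h ^ j * toℕ y → count x ≡ count y
    count-scale j x y x≋h^jy =
      pairCount-relabel (diffPair? x) (diffPair? y) (ℤm.rotate j) (ℤm.rotate-injective j) (λ a b →
      adj-rotate j a b ×-⇔
      (⇔-sym (diff≡⇔ y a b) ⇔-∘ (≋+-scale⇔ (^-≉0 j h≉0) (h^-rotate j a) (h^-rotate j b) x≋h^jy
                                   ⇔-∘ diff≡⇔ x (ℤm.rotate j a) (ℤm.rotate j b))))

    count-negate : ∀ x y → toℕ x + toℕ y ≋ 0 → count x ≡ count y
    count-negate x y x+y≋0 = pairCount-transpose (diffPair? x) (diffPair? y) (λ a b →
      mk⇔ adj-sym adj-sym ×-⇔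
      (⇔-sym (diff≡⇔ y a b) ⇔-∘ (mk⇔ (+≋0⇒≋+ x+y≋0) (+≋0⇒≋+ y+x≋0) ⇔-∘ diff≡⇔ x b a)))
      where
      y+x≋0 : toℕ y + toℕ x ≋ 0
      y+x≋0 = ≋-trans (≋-reflexive (+-comm (toℕ y) (toℕ x))) x+y≋0

    count-zero : count Fin.zero ≡ 0
    count-zero = sum-zero (λ a → sum (λ b → indicator (diffPair? Fin.zero a b))) (λ a →
                 sum-zero (λ b → indicator (diffPair? Fin.zero a b)) (λ b →
                   indicator-no no-pair (diffPair? Fin.zero a b)))
      where
      no-pair : ∀ {a b} → ¬ (Adj a b × diffMod p (f a) (f b) ≡ 0)
      no-pair {a} {b} (adj , diff≡0) = adj-irreflexive (subst (Adj a) (sym a≡b) adj)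
        where
        a≡b : a ≡ b
        a≡b = toℕ-injective (h^-injective (toℕ<n a) (toℕ<n b)
                (≋-trans (Equivalence.to (diff≡⇔ Fin.zero a b) diff≡0) (≋-reflexive (+-identityʳ _))))

    one : Fin p
    one = Fin.suc Fin.zero

    count-constant : ∀ x → toℕ x ≢ 0 → count x ≡ count one
    count-constant x x≢0 = from-cases (power-or-negatedPower x x≢0)
      where
      h^j≋h^j*1 : ∀ j → h ^ j ≋ h ^ j * 1
      h^j≋h^j*1 j = ≋-reflexive (sym (*-identityʳ (h ^ j)))
      from-cases : (∃ λ j → toℕ x ≋ h ^ j ⊎ toℕ x + h ^ j ≋ 0) → count x ≡ count one
      from-cases (j , inj₁ x≋h^j)     = count-scale j x one (≋-trans x≋h^j (h^j≋h^j*1 j))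
      from-cases (j , inj₂ x+h^j≋0) = trans
        (count-negate x y (≋-trans (+-congˡ (toℕ x) y≋h^j) x+h^j≋0))
        (count-scale j y one (≋-trans y≋h^j (h^j≋h^j*1 j)))
        where
        y : Fin p
        y = fromℕ< (m%n<n (h ^ j) p)
        y≋h^j : toℕ y ≋ h ^ j
        y≋h^j = ≋-trans (≋-reflexive (toℕ-fromℕ< (m%n<n (h ^ j) p))) (m%M≋m (h ^ j))

    numDiffPairs≡count : ∀ x → numDiffPairs m n p S f x ≡ count x
    numDiffPairs≡count x = length-filter-allFin² (λ ab → diffPair? x (proj₁ ab) (proj₂ ab))

    numEdges≡ : numEdges m n S ≡ pairCount (ordered? (circAdj? m n S))
    numEdges≡ = length-filter-allFin² (λ ab → ordered? (circAdj? m n S) (proj₁ ab) (proj₂ ab))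

    sum-count : sum count ≡ 2 * numEdges m n S
    sum-count = begin
      sum count
        ≡⟨ sum-pairCount-fibres (circAdj? m n S) (λ a b → diffMod p (f a) (f b))
                                (λ a b → m%n<n (toℕ (f a) + (p ∸ toℕ (f b))) p) ⟩
      pairCount (circAdj? m n S)
        ≡⟨ pairCount-symmetric (circAdj? m n S) adj-sym adj-irreflexive ⟩
      2 * pairCount (ordered? (circAdj? m n S))
        ≡⟨ cong (2 *_) numEdges≡ ⟨
      2 * numEdges m n S
        ∎
      where open ≡-Reasoning

    numDiffPairs*p-1 : ∀ x → toℕ x ≢ 0 → numDiffPairs m n p S f x * p-1 ≡ 2 * numEdges m n S
    numDiffPairs*p-1 x x≢0 = begin
      numDiffPairs m n p S f x * p-1       ≡⟨ cong (_* p-1) (numDiffPairs≡count x) ⟩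
      count x * p-1                        ≡⟨ cong (_* p-1) (count-constant x x≢0) ⟩
      count one * p-1                      ≡⟨ *-comm (count one) p-1 ⟩
      p-1 * count one                      ≡⟨ sum-const p-1 (count one) ⟨
      sum {p-1} (λ _ → count one)          ≡⟨ ∑.sum-cong-≗ {p-1} (λ y → count-constant (Fin.suc y) (λ ())) ⟨
      sum {p-1} (λ y → count (Fin.suc y))  ≡⟨ cong (_+ sum {p-1} (λ y → count (Fin.suc y))) count-zero ⟨
      sum count                            ≡⟨ sum-count ⟩
      2 * numEdges m n S                   ∎
      where open ≡-Reasoning

proposition9p3 : (n : ℕ) → 1 ≤ n → Prime (3 + 4 * n) → (S : Subset n) →
    ∃[ f ] (Injective _≡_ _≡_ f
    × (∀ a → IsNonzeroSquare (3 + 4 * n) (f a))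
    × (∀ (x : Fin (3 + 4 * n)) → ¬ (toℕ x ≡ 0) →
    numDiffPairs (1 + 2 * n) n (3 + 4 * n) S f x * (2 + 4 * n)
    ≡ 2 * numEdges (1 + 2 * n) n S))
proposition9p3 n _ p-prime S = f , f-injective , f-square , numDiffPairs*p-1
  where
  open PaleyLabelling n p-prime
  open DifferenceCounts S
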